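{- Fix a positive integer $K$, and let $f_1,\dots,f_K$ be the functions defined in the context. For every $t\in\{1,\dots,K\}$, $f_t(0,\dots,0,1;1,\dots,1,0)=t\cdot(2t-2)!$, i.e., the value with $r_{K-t+1}=\dots=r_{K-1}=0$, $r_K=1$, $b_{K-t+1}=\dots=b_{K-1}=1$, $b_K=0$.
   Context: Let $m_t=(2t-1)!$. For $t\in\{1,\dots,K\}$, $f_t$ is a function of $r_{K-t+1},\dots,r_K\in\{0,1\}$ and non-negative integers $b_{K-t+1},\dots,b_K$, written $f_t(r_{K-t+1},\dots,r_K;b_{K-t+1},\dots,b_K)$. Put $\hat b_i=\min\{b_i,2(K-i)\}$; each $f_t$ depends on the $b_i$ only through $\hat b_i$. Define $f_1(r_K;b_K)=r_K$. For $t\ge2$, given the arguments, let $\delta_{t-1}=m_{t-1}-f_{t-1}(r_{K-t+2},\dots,r_K;\hat b_{K-t+2},\dots,\hat b_K)$, $d_t=2(t-1)-\hat b_{K-t+1}$, $s_t=1-r_{K-t+1}$, $a_t=2m_{t-1}s_t+\delta_{t-1}(d_t-1)$, and $f_t(r_{K-t+1},\dots,r_K;b_{K-t+1},\dots,b_K)=m_t-a_t d_t$. -}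

module Defs where

open import Data.Nat using (ℕ; zero; suc; _∸_; _⊓_; _!) renaming (_*_ to _*ℕ_)
open import Data.Integer using (ℤ; +_; _-_; _*_; _+_)
open import Data.Bool using (Bool; true; false)
open import Data.Vec using (Vec; []; _∷_)

m : ℕ → ℤ
m t = + ((2 *ℕ t ∸ 1) !)

-- r ∈ {0,1} encoded as Bool, viewed as an integer
⟦_⟧ : Bool → ℤ
⟦ true ⟧  = + 1
⟦ false ⟧ = + 0

-- f t rs bs : the arguments are Vec's of length t listing the entries at
-- positions K-t+1, …, K (head = position K-t+1).
-- The entry at position i = K-t+1 is capped: b̂ = min b (2 (K - i)) = min b (2 (t-1)).
hat : ∀ {t} → Vec ℕ t → Vec ℕ t
hat []              = []
hat {suc t} (b ∷ bs) = (b ⊓ (2 *ℕ t)) ∷ hat bs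

f : (t : ℕ) → Vec Bool t → Vec ℕ t → ℤ
f zero    _              _             = + 0   -- unused (t ≥ 1)
f (suc zero) (r ∷ [])    (b ∷ [])      = ⟦ r ⟧
f (suc (suc n)) (r ∷ rs) (b ∷ bs)      =
  let t  = suc (suc n)
      δ  = m (suc n) - f (suc n) rs (hat bs)
      d  = 2 *ℕ (suc n) ∸ (b ⊓ (2 *ℕ (suc n)))
      s  = + 1 - ⟦ r ⟧
      a  = + 2 * m (suc n) * s + δ * (+ d - + 1)
  in m t - a * + d

rArg : (t : ℕ) → Vec Bool t
rArg zero          = []
rArg (suc zero)    = true ∷ []
rArg (suc (suc n)) = false ∷ rArg (suc n)

bArg : (t : ℕ) → Vec ℕ t
bArg zero          = []
bArg (suc zero)    = 0 ∷ []
bArg (suc (suc n)) = 1 ∷ bArg (suc n)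

module Submission where

-- Along the argument r = (0,…,0,1), b = (1,…,1,0) the cap b̂ never
-- bites, so for t = n + 2 the recursion has s = 1 and d = 2n + 1, and reads
--   f_{n+2} = m_{n+2} − (2 m_{n+1} + (m_{n+1} − f_{n+1}) · 2n) · (2n + 1).
-- Writing X = (2n)! we have m_{n+1} = (2n+1) X and m_{n+2} = (2n+3)(2n+2)(2n+1) X,
-- and by induction f_{n+1} = (n+1) X.  Substituting, the right-hand side is a
-- polynomial identity in n and X whose value is (n+2)(2n+2)(2n+1) X = (n+2)(2n+2)!,
-- which is the claimed closed form at t = n + 2.

open import Defs
open import Data.Nat using (ℕ; zero; suc; _≤_; _∸_; _!) renaming (_*_ to _*ℕ_)
open import Data.Nat.Properties using () renaming (*-suc to *ℕ-suc)
open import Data.Integer using (ℤ; +_; _+_; _-_; _*_)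
open import Data.Integer.Properties using (pos-*)
open import Data.Integer.Tactic.RingSolver using (solve-∀)
open import Data.Vec using (_∷_)
open import Relation.Binary.PropositionalEquality
  using (_≡_; refl; sym; trans; cong; cong₂; module ≡-Reasoning)

open ≡-Reasoning

fact-suc : ∀ k → + (suc k !) ≡ + suc k * + (k !)
fact-suc k = pos-* (suc k) (k !)

m-suc : ∀ n → m (suc n) ≡ + suc (2 *ℕ n) * + ((2 *ℕ n) !)
m-suc n = trans (cong (λ j → + ((j ∸ 1) !)) (*ℕ-suc 2 n)) (fact-suc (2 *ℕ n))

even-fact-suc : ∀ n → let k = 2 *ℕ n in
  + ((2 *ℕ suc n) !) ≡ + suc (suc k) * (+ suc k * + (k !))
even-fact-suc n = begin
  + ((2 *ℕ suc n) !)                                  ≡⟨ cong (λ j → + (j !)) (*ℕ-suc 2 n) ⟩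
  + (suc (suc k) !)                                   ≡⟨ fact-suc (suc k) ⟩
  + suc (suc k) * + (suc k !)                         ≡⟨ cong (+ suc (suc k) *_) (fact-suc k) ⟩
  + suc (suc k) * (+ suc k * + (k !))                 ∎
  where k = 2 *ℕ n

m-suc-suc : ∀ n → let k = 2 *ℕ n in
  m (suc (suc n)) ≡ + suc (suc (suc k)) * (+ suc (suc k) * (+ suc k * + (k !)))
m-suc-suc n = trans (m-suc (suc n))
  (cong₂ _*_ (cong (λ j → + suc j) (*ℕ-suc 2 n)) (even-fact-suc n))

-- Capping leaves the b-argument (1,…,1,0) unchanged: 1 ≤ 2(K−i) for i < K, and b_K = 0.
hat-bArg : ∀ t → hat (bArg t) ≡ bArg t
hat-bArg zero          = refl
hat-bArg (suc zero)    = refl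
hat-bArg (suc (suc n)) = cong (1 ∷_) (hat-bArg (suc n))

-- The right-hand side of the recursion for f_t when r_{K-t+1} = 0 (so s_t = 1),
-- as a function of m_t, m_{t-1}, f_{t-1} and d_t.
recurrence : (M₂ M₁ F D : ℤ) → ℤ
recurrence M₂ M₁ F D = M₂ - (+ 2 * M₁ * (+ 1 - + 0) + (M₁ - F) * (D - + 1)) * D

f-path-unfold : ∀ n →
  f (suc (suc n)) (rArg (suc (suc n))) (bArg (suc (suc n)))
    ≡ recurrence (m (suc (suc n))) (m (suc n))
                 (f (suc n) (rArg (suc n)) (bArg (suc n))) (+ (2 *ℕ suc n ∸ 1))
f-path-unfold n rewrite hat-bArg (suc n) = refl

recurrence-closed-form : ∀ N k X → k ≡ + 2 * N →
  recurrence ((+ 3 + k) * ((+ 2 + k) * ((+ 1 + k) * X))) ((+ 1 + k) * X)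
             ((+ 1 + N) * X) (+ 1 + k)
    ≡ (+ 2 + N) * ((+ 2 + k) * ((+ 1 + k) * X))
recurrence-closed-form N .(+ 2 * N) X refl = identity N X
  where
  identity : ∀ N X →
    (+ 3 + + 2 * N) * ((+ 2 + + 2 * N) * ((+ 1 + + 2 * N) * X))
      - (+ 2 * ((+ 1 + + 2 * N) * X) * (+ 1 - + 0)
         + ((+ 1 + + 2 * N) * X - (+ 1 + N) * X) * ((+ 1 + + 2 * N) - + 1))
        * (+ 1 + + 2 * N)
    ≡ (+ 2 + N) * ((+ 2 + + 2 * N) * ((+ 1 + + 2 * N) * X))
  identity = solve-∀

f-path : ∀ n → f (suc n) (rArg (suc n)) (bArg (suc n)) ≡ + suc n * + ((2 *ℕ n) !)
f-path zero    = refl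
f-path (suc n) = begin
  f (suc (suc n)) (rArg (suc (suc n))) (bArg (suc (suc n)))
    ≡⟨ f-path-unfold n ⟩
  recurrence (m (suc (suc n))) (m (suc n))
             (f (suc n) (rArg (suc n)) (bArg (suc n))) (+ (2 *ℕ suc n ∸ 1))
    ≡⟨ cong-recurrence (m-suc-suc n) (m-suc n) (f-path n) d-value ⟩
  recurrence ((+ 3 + k) * ((+ 2 + k) * ((+ 1 + k) * X))) ((+ 1 + k) * X)
             ((+ 1 + + n) * X) (+ 1 + k)
    ≡⟨ recurrence-closed-form (+ n) k X (pos-* 2 n) ⟩
  (+ 2 + + n) * ((+ 2 + k) * ((+ 1 + k) * X))
    ≡⟨ cong (+ suc (suc n) *_) (sym (even-fact-suc n)) ⟩
  + suc (suc n) * + ((2 *ℕ suc n) !)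
    ∎
  where
  k X : ℤ
  k = + (2 *ℕ n)
  X = + ((2 *ℕ n) !)

  d-value : + (2 *ℕ suc n ∸ 1) ≡ + 1 + k
  d-value = cong (λ j → + (j ∸ 1)) (*ℕ-suc 2 n)

  cong-recurrence : ∀ {M₂ M₂′ M₁ M₁′ F F′ D D′} →
    M₂ ≡ M₂′ → M₁ ≡ M₁′ → F ≡ F′ → D ≡ D′ →
    recurrence M₂ M₁ F D ≡ recurrence M₂′ M₁′ F′ D′
  cong-recurrence refl refl refl refl = refl

closed-form : ∀ n → + (suc n *ℕ ((2 *ℕ suc n ∸ 2) !)) ≡ + suc n * + ((2 *ℕ n) !)
closed-form n = trans (cong (λ j → + (suc n *ℕ ((j ∸ 2) !))) (*ℕ-suc 2 n))
                      (pos-* (suc n) ((2 *ℕ n) !))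

lemma3p5 : (K : ℕ) → 1 ≤ K → (t : ℕ) → 1 ≤ t → t ≤ K →
    f t (rArg t) (bArg t) ≡ + (t *ℕ ((2 *ℕ t ∸ 2) !))
lemma3p5 K _ (suc n) _ _ = trans (f-path n) (sym (closed-form n))
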